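{- Let $G$ be an abelian group, let $S$ be a sequence over $G$, and let $W$ be a sequence of consecutive integers with $|W|=|S|$. Then $\langle W\odot S\rangle_*=\langle \operatorname{supp}(S)\rangle_*$.
   Context: Sequences are finite unordered lists with repetition (multisets); $|S|$ is the length. For $W=w_1\cdot\ldots\cdot w_n$ and $S=s_1\cdot\ldots\cdot s_n$ of equal length, $W\odot S=\{w_{\tau(1)}s_1+\ldots+w_{\tau(n)}s_n:\ \tau\text{ a permutation of }1,\ldots,n\}$. $\operatorname{supp}(S)$ is the set of distinct terms of $S$. For a subset $A\subseteq G$, $\langle A\rangle_*=\langle A-A\rangle$ denotes the smallest subgroup $H$ of $G$ such that $A$ is contained in a coset of $H$. -}

module Defs where

open import Level using (Level; _⊔_; Lift)
open import Algebra.Bundles using (AbelianGroup)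
open import Data.Nat using (ℕ; zero; suc)
open import Data.Integer using (ℤ; +_; -[1+_]) renaming (_+_ to _+ℤ_)
open import Data.List using (List; []; _∷_; length; zipWith; foldr; upTo; map)
open import Data.List.Relation.Unary.Any using (Any)
open import Data.List.Relation.Binary.Permutation.Propositional using (_↭_)
open import Data.Product using (Σ; ∃; _×_)

module _ {c ℓ : Level} (G : AbelianGroup c ℓ) where
  open AbelianGroup G

  ℕmul : ℕ → Carrier → Carrier
  ℕmul zero    x = ε
  ℕmul (suc n) x = x ∙ ℕmul n x

  ℤmul : ℤ → Carrier → Carrier
  ℤmul (+ n)      x = ℕmul n x
  ℤmul -[1+ n ]   x = (ℕmul (suc n) x) ⁻¹

  σ : List Carrier → Carrier
  σ = foldr _∙_ ε

  Subset : Set _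
  Subset = Carrier → Set (c ⊔ ℓ)

  data ⟨_⟩ (A : Subset) : Carrier → Set (c ⊔ ℓ) where
    gen  : ∀ {x} → A x → ⟨ A ⟩ x
    unit : ⟨ A ⟩ ε
    add  : ∀ {x y} → ⟨ A ⟩ x → ⟨ A ⟩ y → ⟨ A ⟩ (x ∙ y)
    inv  : ∀ {x} → ⟨ A ⟩ x → ⟨ A ⟩ (x ⁻¹)
    resp : ∀ {x y} → x ≈ y → ⟨ A ⟩ x → ⟨ A ⟩ y

  diff : Subset → Subset
  diff A z = Σ Carrier λ a → Σ Carrier λ b → A a × A b × (z ≈ a ∙ b ⁻¹)

  ⟨_⟩* : Subset → Subset
  ⟨ A ⟩* = ⟨ diff A ⟩

  supp : List Carrier → Subset
  supp S x = Any (λ s → x ≈ s) S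

  -- W ⊙ S = { Σ_i w_{τ(i)} s_i : τ a permutation }, where |W| = |S|
  _⊙_ : List ℤ → List Carrier → Subset
  (W ⊙ S) z = Lift (c ⊔ ℓ) (Σ (List ℤ) λ W′ → (W′ ↭ W) × (z ≈ σ (zipWith ℤmul W′ S)))

  _≐_ : Subset → Subset → Set _
  A ≐ B = ∀ z → (A z → B z) × (B z → A z)

consec : ℤ → ℕ → List ℤ
consec a n = map (λ i → a +ℤ + i) (upTo n)

module Submission where

-- Write Σ(V, S) = Σᵢ vᵢ sᵢ (wsum below), so that W ⊙ S = { Σ(V, S) : V ↭ W }.
--
-- (⊆)  This holds for every W with |W| = |S|.  Two elements of W ⊙ S are
--      Σ(V₁, S) and Σ(V₂, S) with V₁ ↭ V₂.  By induction on the permutation,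
--      Σ(V₁, S) − Σ(V₂, S) is a sum of terms k·u − k·v with u, v ∈ supp S,
--      and each such term lies in ⟨supp S⟩* (it is k copies of u − v).
-- (⊇)  Here consecutiveness is used.  With W = (a, a+1, …, a+n−1) and
--      S = s₁ … sₙ, exchanging the two leading weights changes the sum by
--      (a·s₁ + (a+1)·s₂) − ((a+1)·s₁ + a·s₂) = s₂ − s₁.  Prepending a·s to all
--      elements of (a+1, …) ⊙ S′ does not change their differences, so by
--      induction x − s₁ ∈ ⟨W ⊙ S⟩* for every x ∈ supp S, and hence
--      x − y = (x − s₁) − (y − s₁) ∈ ⟨W ⊙ S⟩* for all x, y ∈ supp S.

open import Defs
open import Level using (Level; _⊔_; lift)
open import Algebra.Bundles using (AbelianGroup)
open import Data.Integer using (ℤ; +_; -[1+_]) renaming (_+_ to _+ℤ_)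
open import Data.Integer.Properties using (+-assoc; +-identityʳ)
open import Data.Nat using (zero; suc) renaming (_+_ to _ℕ+_)
open import Data.Nat.Properties using (suc-injective)
open import Data.List using (List; []; _∷_; length; zipWith; map; upTo; applyUpTo)
open import Data.List.Properties using (map-applyUpTo; map-upTo; map-cong; length-map; length-upTo)
open import Data.List.Relation.Unary.Any using (here; there)
open import Data.List.Relation.Binary.Permutation.Propositional
  using (_↭_; ↭-reflexive; ↭-sym; ↭-trans)
import Data.List.Relation.Binary.Permutation.Propositional as ↭
open import Data.List.Relation.Binary.Permutation.Propositional.Properties using (↭-length)
open import Data.Product using (_,_)
open import Function using (_∘_; id)
open import Relation.Binary.PropositionalEquality as ≡ using (_≡_)

consec-suc : ∀ a n → consec a (suc n) ≡ a ∷ consec (a +ℤ + 1) n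
consec-suc a n = ≡.cong₂ _∷_ (+-identityʳ a) (begin
  map (λ i → a +ℤ + i) (applyUpTo suc n)  ≡⟨ map-applyUpTo suc _ n ⟩
  applyUpTo (λ i → a +ℤ + suc i) n        ≡⟨ ≡.sym (map-upTo _ n) ⟩
  map (λ i → a +ℤ + suc i) (upTo n)       ≡⟨ map-cong (λ i → ≡.sym (+-assoc a (+ 1) (+ i))) (upTo n) ⟩
  consec (a +ℤ + 1) n                     ∎)
  where open ≡.≡-Reasoning

length-consec : ∀ a n → length (consec a n) ≡ n
length-consec a n = ≡.trans (length-map _ (upTo n)) (length-upTo n)

module _ {c ℓ : Level} (G : AbelianGroup c ℓ) where
  open AbelianGroup G
  open import Algebra.Properties.AbelianGroup G using (⁻¹-∙-comm; ⁻¹-anti-homo‿-)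
  open import Algebra.Properties.CommutativeSemigroup commutativeSemigroup
    using (interchange; x∙yz≈y∙xz)
  open import Relation.Binary.Reasoning.Setoid setoid

  -‿interchange : ∀ a b c d → (a ∙ b) - (c ∙ d) ≈ (a - c) ∙ (b - d)
  -‿interchange a b c d =
    trans (∙-congˡ (sym (⁻¹-∙-comm c d))) (interchange a b (c ⁻¹) (d ⁻¹))

  -- The same for three terms, pairing the first two terms crosswise; this is
  -- the shape of the difference when two adjacent weights are exchanged.
  -‿interchange₃ : ∀ a b c d e f →
    (a ∙ (b ∙ c)) - (d ∙ (e ∙ f)) ≈ (a - e) ∙ ((b - d) ∙ (c - f))
  -‿interchange₃ a b c d e f = begin
    (a ∙ (b ∙ c)) - (d ∙ (e ∙ f))      ≈⟨ ∙-congˡ (⁻¹-cong (x∙yz≈y∙xz d e f)) ⟩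
    (a ∙ (b ∙ c)) - (e ∙ (d ∙ f))      ≈⟨ -‿interchange a (b ∙ c) e (d ∙ f) ⟩
    (a - e) ∙ ((b ∙ c) - (d ∙ f))      ≈⟨ ∙-congˡ (-‿interchange b c d f) ⟩
    (a - e) ∙ ((b - d) ∙ (c - f))      ∎

  -‿telescope : ∀ a b d → a - d ≈ (a - b) ∙ (b - d)
  -‿telescope a b d = sym (begin
    (a - b) ∙ (b - d)        ≈⟨ assoc a (b ⁻¹) (b - d) ⟩
    a ∙ (b ⁻¹ ∙ (b - d))     ≈⟨ ∙-congˡ (sym (assoc (b ⁻¹) b (d ⁻¹))) ⟩
    a ∙ ((b ⁻¹ ∙ b) ∙ d ⁻¹)  ≈⟨ ∙-congˡ (∙-congʳ (inverseˡ b)) ⟩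
    a ∙ (ε ∙ d ⁻¹)           ≈⟨ ∙-congˡ (identityˡ (d ⁻¹)) ⟩
    a - d                    ∎)

  -‿translate : ∀ p u v → (p ∙ u) - (p ∙ v) ≈ u - v
  -‿translate p u v =
    trans (-‿interchange p u p v) (trans (∙-congʳ (inverseʳ p)) (identityˡ _))

  -‿absorbˡ : ∀ x y → (x ∙ y) - x ≈ y
  -‿absorbˡ x y =
    trans (∙-congʳ (comm x y)) (trans (assoc y x (x ⁻¹)) (trans (∙-congˡ (inverseʳ x)) (identityʳ y)))

  -‿absorbʳ : ∀ x y → x - (x ∙ y) ≈ y ⁻¹
  -‿absorbʳ x y = trans (sym (⁻¹-anti-homo‿- (x ∙ y) x)) (⁻¹-cong (-‿absorbˡ x y))

  ℕmul-suc : ∀ n x → ℕmul G (n ℕ+ 1) x ≈ ℕmul G n x ∙ x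
  ℕmul-suc zero    x = comm x ε
  ℕmul-suc (suc n) x = trans (∙-congˡ (ℕmul-suc n x)) (sym (assoc x (ℕmul G n x) x))

  ℤmul-suc : ∀ k x → ℤmul G (k +ℤ + 1) x ≈ ℤmul G k x ∙ x
  ℤmul-suc (+ n)          x = ℕmul-suc n x
  ℤmul-suc -[1+ zero ]    x = sym (trans (∙-congʳ (⁻¹-cong (identityʳ x))) (inverseˡ x))
  ℤmul-suc -[1+ suc n ]   x = sym (begin
    (x ∙ M) ⁻¹ ∙ x      ≈⟨ comm _ x ⟩
    x - (x ∙ M)         ≈⟨ -‿absorbʳ x M ⟩
    M ⁻¹                ∎)
    where M = ℕmul G (suc n) x

  ⟪_⟫ : Subset G → Subset G
  ⟪ A ⟫ = ⟨_⟩ G A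

  ⟪_⟫* : Subset G → Subset G
  ⟪ A ⟫* = ⟨_⟩* G A

  infix 4 _⊆_
  _⊆_ : Subset G → Subset G → Set (c ⊔ ℓ)
  A ⊆ B = ∀ {z} → A z → B z

  ⟪⟫-least : ∀ {A B} → A ⊆ ⟪ B ⟫ → ⟪ A ⟫ ⊆ ⟪ B ⟫
  ⟪⟫-least A⊆B (gen a)     = A⊆B a
  ⟪⟫-least A⊆B unit        = unit
  ⟪⟫-least A⊆B (add x y)   = add (⟪⟫-least A⊆B x) (⟪⟫-least A⊆B y)
  ⟪⟫-least A⊆B (inv x)     = inv (⟪⟫-least A⊆B x)
  ⟪⟫-least A⊆B (resp e x)  = resp e (⟪⟫-least A⊆B x)

  ⟪⟫-≈ε : ∀ {A x} → x ≈ ε → ⟪ A ⟫ x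
  ⟪⟫-≈ε x≈ε = resp (sym x≈ε) unit

  diff-∈ : ∀ {A x y} → A x → A y → ⟪ A ⟫* (x - y)
  diff-∈ {x = x} {y} ax ay = gen (x , y , ax , ay , refl)

  ⟪⟫*-translate : ∀ {A B} p → (∀ {z} → A z → B (p ∙ z)) → ⟪ A ⟫* ⊆ ⟪ B ⟫*
  ⟪⟫*-translate p p+A⊆B = ⟪⟫-least λ where
    (x , y , ax , ay , z≈x-y) →
      resp (sym (trans z≈x-y (sym (-‿translate p x y)))) (diff-∈ (p+A⊆B ax) (p+A⊆B ay))

  ⟪⟫*-mono : ∀ {A B} → A ⊆ B → ⟪ A ⟫* ⊆ ⟪ B ⟫*
  ⟪⟫*-mono A⊆B = ⟪⟫-least λ where
    (x , y , ax , ay , z≈x-y) → resp (sym z≈x-y) (diff-∈ (A⊆B ax) (A⊆B ay))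

  ℕmul-diff : ∀ {T u v} → T u → T v → ∀ n → ⟪ T ⟫* (ℕmul G n u - ℕmul G n v)
  ℕmul-diff tu tv zero    = ⟪⟫-≈ε (inverseʳ ε)
  ℕmul-diff {u = u} {v} tu tv (suc n) =
    resp (sym (-‿interchange u (ℕmul G n u) v (ℕmul G n v))) (add (diff-∈ tu tv) (ℕmul-diff tu tv n))

  ℤmul-diff : ∀ {T u v} → T u → T v → ∀ k → ⟪ T ⟫* (ℤmul G k u - ℤmul G k v)
  ℤmul-diff tu tv (+ n)    = ℕmul-diff tu tv n
  ℤmul-diff tu tv -[1+ n ] = resp (sym (⁻¹-∙-comm _ _)) (inv (ℕmul-diff tu tv (suc n)))

  wsum : List ℤ → List Carrier → Carrier
  wsum V S = σ G (zipWith (ℤmul G) V S)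

  -- The length
  -- condition matters: zipWith would otherwise drop different weights.
  wsum-↭-diff : ∀ {T V₁ V₂} S → V₁ ↭ V₂ → length V₁ ≡ length S → supp G S ⊆ T →
    ⟪ T ⟫* (wsum V₁ S - wsum V₂ S)
  wsum-↭-diff S ↭.refl _ _ = ⟪⟫-≈ε (inverseʳ _)
  wsum-↭-diff [] (↭.prep k p) _ _ = ⟪⟫-≈ε (inverseʳ _)
  wsum-↭-diff (s ∷ S) (↭.prep k p) len S⊆T =
    resp (sym (-‿interchange _ _ _ _))
      (add (ℤmul-diff s∈T s∈T k) (wsum-↭-diff S p (suc-injective len) (S⊆T ∘ there)))
    where s∈T = S⊆T (here refl)
  wsum-↭-diff [] (↭.swap k l p) _ _ = ⟪⟫-≈ε (inverseʳ _)
  wsum-↭-diff (s ∷ []) (↭.swap k l p) ()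
  wsum-↭-diff (s ∷ s′ ∷ S) (↭.swap k l p) len S⊆T =
    resp (sym (-‿interchange₃ _ _ _ _ _ _))
      (add (ℤmul-diff s∈T s′∈T k) (add (ℤmul-diff s′∈T s∈T l)
        (wsum-↭-diff S p (suc-injective (suc-injective len)) (S⊆T ∘ there ∘ there))))
    where s∈T = S⊆T (here refl)
          s′∈T = S⊆T (there (here refl))
  wsum-↭-diff S (↭.trans p q) len S⊆T =
    resp (sym (-‿telescope _ _ _))
      (add (wsum-↭-diff S p len S⊆T) (wsum-↭-diff S q (≡.trans (≡.sym (↭-length p)) len) S⊆T))

  ⊙-⊆-supp : ∀ W S → length W ≡ length S → ⟪ _⊙_ G W S ⟫* ⊆ ⟪ supp G S ⟫*
  ⊙-⊆-supp W S len = ⟪⟫-least λ where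
    (x , y , lift (V₁ , V₁↭W , x≈) , lift (V₂ , V₂↭W , y≈) , z≈x-y) →
      resp (sym (trans z≈x-y (∙-cong x≈ (⁻¹-cong y≈))))
        (wsum-↭-diff S (↭-trans V₁↭W (↭-sym V₂↭W)) (≡.trans (↭-length V₁↭W) len) id)

  ⊙-↭ : ∀ {W₁ W₂} S → W₁ ↭ W₂ → _⊙_ G W₁ S ⊆ _⊙_ G W₂ S
  ⊙-↭ S W₁↭W₂ (lift (V , V↭W₁ , z≈)) = lift (V , ↭-trans V↭W₁ W₁↭W₂ , z≈)

  consec⊙ : ℤ → List Carrier → Subset G
  consec⊙ a S = _⊙_ G (consec a (length S)) S

  consec⊙-cons : ∀ a s S {z} → consec⊙ (a +ℤ + 1) S z → consec⊙ a (s ∷ S) (ℤmul G a s ∙ z)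
  consec⊙-cons a s S (lift (V , V↭ , z≈)) =
    lift (a ∷ V , ↭-trans (↭.prep a V↭) (↭-reflexive (≡.sym (consec-suc a (length S)))) , ∙-congˡ z≈)

  -- Exchanging the weights a and a+1 of the first two terms s, s′ changes the
  -- sum by s′ − s, so s′ − s ∈ ⟨(a, …) ⊙ (s ∷ s′ ∷ S)⟩*.
  adjacent-swap : ∀ a s s′ S → ⟪ consec⊙ a (s ∷ s′ ∷ S) ⟫* (s′ - s)
  adjacent-swap a s s′ S = resp difference (diff-∈ x∈ y∈)
    where
    b = a +ℤ + 1
    V = consec (b +ℤ + 1) (length S)
    consec≡ : consec a (suc (suc (length S))) ≡ a ∷ b ∷ V
    consec≡ = ≡.trans (consec-suc a (suc (length S))) (≡.cong (a ∷_) (consec-suc b (length S)))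
    x∈ : consec⊙ a (s ∷ s′ ∷ S) (wsum (a ∷ b ∷ V) (s ∷ s′ ∷ S))
    x∈ = lift (a ∷ b ∷ V , ↭-reflexive (≡.sym consec≡) , refl)
    y∈ : consec⊙ a (s ∷ s′ ∷ S) (wsum (b ∷ a ∷ V) (s ∷ s′ ∷ S))
    y∈ = lift (b ∷ a ∷ V , ↭-trans (↭.swap b a ↭.refl) (↭-reflexive (≡.sym consec≡)) , refl)
    R = wsum V S
    as = ℤmul G a s
    as′ = ℤmul G a s′
    difference : wsum (a ∷ b ∷ V) (s ∷ s′ ∷ S) - wsum (b ∷ a ∷ V) (s ∷ s′ ∷ S) ≈ s′ - s
    difference = begin
      (as ∙ (ℤmul G b s′ ∙ R)) - (ℤmul G b s ∙ (as′ ∙ R))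
        ≈⟨ -‿interchange _ _ _ _ ⟩
      (as - ℤmul G b s) ∙ ((ℤmul G b s′ ∙ R) - (as′ ∙ R))
        ≈⟨ ∙-congˡ (-‿interchange _ _ _ _) ⟩
      (as - ℤmul G b s) ∙ ((ℤmul G b s′ - as′) ∙ (R - R))
        ≈⟨ ∙-cong (∙-congˡ (⁻¹-cong (ℤmul-suc a s))) (∙-cong (∙-congʳ (ℤmul-suc a s′)) (inverseʳ R)) ⟩
      (as - (as ∙ s)) ∙ (((as′ ∙ s′) - as′) ∙ ε)
        ≈⟨ ∙-cong (-‿absorbʳ as s) (trans (identityʳ _) (-‿absorbˡ as′ s′)) ⟩
      s ⁻¹ ∙ s′
        ≈⟨ comm (s ⁻¹) s′ ⟩
      s′ - s ∎

  -- Every term x of s ∷ S satisfies x − s ∈ ⟨(a, …) ⊙ (s ∷ S)⟩*: for x in the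
  -- tail, x − s = (x − s′) + (s′ − s), where x − s′ comes from the tail by
  -- induction and translation, and s′ − s from adjacent-swap.
  supp-minus-head : ∀ a s S {x} → supp G (s ∷ S) x → ⟪ consec⊙ a (s ∷ S) ⟫* (x - s)
  supp-minus-head a s S       (here x≈s)  = ⟪⟫-≈ε (trans (∙-congʳ x≈s) (inverseʳ s))
  supp-minus-head a s []      (there ())
  supp-minus-head a s (s′ ∷ S) {x} (there x∈) = resp (sym (-‿telescope x s′ s))
    (add (⟪⟫*-translate (ℤmul G a s) (consec⊙-cons a s (s′ ∷ S)) (supp-minus-head (a +ℤ + 1) s′ S x∈))
         (adjacent-swap a s s′ S))

  -- The inclusion ⟨supp S⟩* ⊆ ⟨(a, a+1, …) ⊙ S⟩*, via x − y = (x − s) − (y − s).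
  supp-⊆-consec⊙ : ∀ a S → ⟪ supp G S ⟫* ⊆ ⟪ consec⊙ a S ⟫*
  supp-⊆-consec⊙ a []      = ⟪⟫-least λ where (_ , _ , () , _)
  supp-⊆-consec⊙ a (s ∷ S) = ⟪⟫-least λ where
    (x , y , x∈ , y∈ , z≈x-y) → resp (sym (trans z≈x-y (-‿telescope x s y)))
      (add (supp-minus-head a s S x∈) (resp (⁻¹-anti-homo‿- y s) (inv (supp-minus-head a s S y∈))))

lemma3p3 : {c ℓ : Level} (G : AbelianGroup c ℓ) (S : List (AbelianGroup.Carrier G))
    (W : List ℤ) (a : ℤ) → W ↭ consec a (length S) →
    _≐_ G (⟨_⟩* G (_⊙_ G W S)) (⟨_⟩* G (supp G S))
lemma3p3 G S W a W↭consec z =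
  ⊙-⊆-supp G W S |W|≡|S| ,
  λ z∈ → ⟪⟫*-mono G (⊙-↭ G S (↭-sym W↭consec)) (supp-⊆-consec⊙ G a S z∈)
  where
  |W|≡|S| : length W ≡ length S
  |W|≡|S| = ≡.trans (↭-length W↭consec) (length-consec a (length S))
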